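{- The map $[\mathbf i]\mapsto[P_{\mathbf i}]$ is a bijection from the set of commutation classes of Gelfand--Cetlin type reduced words in $\mathscr R(w_0^{(n+1)})$ to the set of isomorphism classes of Gelfand--Cetlin type word posets in $\mathcal P(w_0^{(n+1)})$. In particular these two sets have the same cardinality.
   Context: $\mathfrak S_{n+1}$ is the symmetric group with simple transpositions $s_i=(i,i+1)$; $\mathscr R(w)$ is the set of reduced words of $w$; $w_0^{(n+1)}$ is the longest element. Commutation classes: reduced words related by sequences of swaps of adjacent entries $i,j$ with $|i-j|>1$. A word poset is a finite poset $P$ with $f_P:P\to\mathbb{Z}_{>0}$; $P\sim Q$ if there is a poset isomorphism $\phi$ with $f_Q\circ\phi=f_P$. For $\mathbf i=(i_1,\dots,i_\ell)\in\mathscr R(w)$, $P_{\mathbf i}$ is the poset on $[\ell]$ generated by $j<k$ for $j<k$ with $|i_j-i_k|=1$, with $f_{P_{\mathbf i}}(j)=i_j$; $\mathcal P(w)$ is the set of word posets isomorphic to some $P_{\mathbf i}$. For $P\in\mathcal P(w_0^{(n+1)})$, $\mathsf D(P)=\{d_1<_P\cdots<_P d_n\}$ is the unique chain with $f_P(d_i)=n+1-i$ and $\mathsf A(P)=\{a_1<_P\cdots<_P a_n\}$ the unique chain with $f_P(a_i)=i$. $\mathrm{ind}_{\mathsf D}(P)=\sum_i\#\{k: k>_P d_i,\ f_P(k)=f_P(d_i)\}$, $\mathrm{ind}_{\mathsf A}(P)=\sum_i\#\{k: k>_P a_i,\ f_P(k)=f_P(a_i)\}$. With $I_{\mathsf D}(P)=\{k: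 k<_P d_i,\ f_P(k)=f_P(d_i)\text{ for some } i\}$ and $I_{\mathsf A}(P)$ analogous: $C_{\mathsf D}(P)=P\setminus\mathsf D(P)$ with $f=f_P$ on $I_{\mathsf D}(P)$, $f_P-1$ elsewhere; $C_{\mathsf A}(P)=P\setminus\mathsf A(P)$ with $f=f_P-1$ on $I_{\mathsf A}(P)$, $f_P$ elsewhere (induced orders); both in $\mathcal P(w_0^{(n)})$. For $\delta\in\{\mathsf A,\mathsf D\}^{n-1}$, $\mathrm{ind}_\delta(P)=(I_1,\dots,I_{n-1})$ with $I_k=\mathrm{ind}_{\delta_k}(C_{\delta_{k+1}}\circ\cdots\circ C_{\delta_{n-1}}(P))$. $P$ is of Gelfand--Cetlin type if $\mathrm{ind}_\delta(P)=(0,\dots,0)$ for some $\delta$; $\mathbf i$ is of Gelfand--Cetlin type if $P_{\mathbf i}$ is. -}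

module Defs where

open import Data.Nat using (ℕ; zero; suc; _+_; _∸_; _≤_; _<_; _<ᵇ_; _≡ᵇ_; ∣_-_∣)
open import Data.Bool using (Bool; true; false; _∧_; _∨_; not; T; if_then_else_)
open import Data.Fin using (Fin; toℕ)
import Data.Fin as Fin
open import Data.List using (List; []; _∷_; _++_; length; lookup; allFin; map; reverse; upTo)
open import Data.Bool.ListAction using (any)
open import Data.Nat.ListAction using (sum)
open import Data.List.Relation.Unary.All using (All)
open import Data.Vec using (Vec; []; _∷_; last; init; replicate)
open import Data.Product using (Σ; Σ-syntax; ∃; _×_; _,_; proj₁)
open import Relation.Nullary using (¬_)
open import Relation.Nullary.Decidable using (⌊_⌋)
open import Relation.Binary.PropositionalEquality using (_≡_; _≢_; refl)
open import Relation.Binary.Construct.Closure.Equivalence using (EqClosure)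
open import Function.Bundles using (_↔_; Inverse)
open import Function.Construct.Identity using (↔-id)

-- A word in the generators s₁,…,sₙ of S_{n+1}: all letters lie in [1,n].
ValidWord : ℕ → List ℕ → Set
ValidWord n = All (λ a → 1 ≤ a × a ≤ n)

-- right multiplication by sᵢ on a permutation in one-line notation:
-- swap the entries in positions i and i+1 (positions 1-based)
swapAt : ℕ → List ℕ → List ℕ
swapAt (suc zero) (a ∷ b ∷ xs) = b ∷ a ∷ xs
swapAt (suc (suc i)) (x ∷ xs) = x ∷ swapAt (suc i) xs
swapAt _ xs = xs

idPerm : ℕ → List ℕ
idPerm n = map suc (upTo (suc n))

prodFrom : List ℕ → List ℕ → List ℕ
prodFrom w [] = w
prodFrom w (i ∷ is) = prodFrom (swapAt i w) is

prod : ℕ → List ℕ → List ℕ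
prod n = prodFrom (idPerm n)

w₀ : ℕ → List ℕ
w₀ n = reverse (idPerm n)

IsReducedW₀ : ℕ → List ℕ → Set
IsReducedW₀ n i =
  ValidWord n i × prod n i ≡ w₀ n ×
  (∀ j → ValidWord n j → prod n j ≡ w₀ n → length i ≤ length j)

data CommStep : List ℕ → List ℕ → Set where
  comm : ∀ pre a b post → 1 < ∣ a - b ∣ →
         CommStep (pre ++ a ∷ b ∷ post) (pre ++ b ∷ a ∷ post)

_∼comm_ : List ℕ → List ℕ → Set
_∼comm_ = EqClosure CommStep

record WordPoset : Set where
  field
    size  : ℕ
    _≤ᵖ_  : Fin size → Fin size → Bool
    label : Fin size → ℕ
open WordPoset public

_⊢_<ᵖ_ : (P : WordPoset) → Fin (size P) → Fin (size P) → Bool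
P ⊢ x <ᵖ y = _≤ᵖ_ P x y ∧ not ⌊ x Fin.≟ y ⌋

_≅_ : WordPoset → WordPoset → Set
P ≅ Q = Σ[ φ ∈ (Fin (size P) ↔ Fin (size Q)) ]
          ((∀ x y → _≤ᵖ_ P x y ≡ _≤ᵖ_ Q (Inverse.to φ x) (Inverse.to φ y)) ×
           (∀ x → label Q (Inverse.to φ x) ≡ label P x))

≅-refl : ∀ {P} → P ≅ P
≅-refl = ↔-id _ , (λ _ _ → refl) , (λ _ → refl)

-- P_𝐢 : positions 0,…,ℓ-1 (0-based), order generated by j < k
-- whenever j < k and |i_j - i_k| = 1, labels f(j) = i_j.
-- The generated order is the reflexive–transitive closure of the
-- covering relation; x ≤ y iff there is a chain of generating
-- relations of length ≤ fuel from x to y (fuel = ℓ suffices since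
-- generating relations strictly increase the position).
reach : ∀ {ℓ} → ℕ → (Fin ℓ → Fin ℓ → Bool) → Fin ℓ → Fin ℓ → Bool
reach zero    gen j k = ⌊ j Fin.≟ k ⌋
reach {ℓ} (suc f) gen j k =
  ⌊ j Fin.≟ k ⌋ ∨ any (λ l → gen j l ∧ reach f gen l k) (allFin ℓ)

genRel : (i : List ℕ) → Fin (length i) → Fin (length i) → Bool
genRel i j k = (toℕ j <ᵇ toℕ k) ∧ (∣ lookup i j - lookup i k ∣ ≡ᵇ 1)

P[_] : List ℕ → WordPoset
P[ i ] = record
  { size  = length i
  ; _≤ᵖ_  = reach (length i) (genRel i)
  ; label = lookup i
  }

InP-w₀ : ℕ → WordPoset → Set
InP-w₀ n P = Σ[ i ∈ List ℕ ] (IsReducedW₀ n i × P ≅ P[ i ])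

-- The chains 𝖠(P), 𝖣(P), indices, contractions.
-- Throughout, r is the rank: P ∈ 𝓟(w₀^{(r+1)}), chains have length r;
-- chain elements are indexed 0-based by Fin r.

data Dir : Set where
  𝖠 𝖣 : Dir

-- c is the chain 𝖣(P) resp. 𝖠(P):  c₁ <_P ⋯ <_P c_r with
-- f(d_i) = r+1-i  resp.  f(a_i) = i  (1-based i)
IsChain : Dir → (r : ℕ) → (P : WordPoset) → (Fin r → Fin (size P)) → Set
IsChain δ r P c =
  (∀ (i j : Fin r) → toℕ i < toℕ j → T (P ⊢ c i <ᵖ c j)) ×
  (∀ (i : Fin r) → label P (c i) ≡ chainLabel δ i)
  where
  chainLabel : Dir → Fin r → ℕ
  chainLabel 𝖣 i = r ∸ toℕ i
  chainLabel 𝖠 i = suc (toℕ i)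

countAbove : (P : WordPoset) → Fin (size P) → ℕ
countAbove P x =
  sum (map (λ k → if (P ⊢ x <ᵖ k) ∧ (label P k ≡ᵇ label P x) then 1 else 0)
           (allFin (size P)))

IndIs : Dir → (r : ℕ) → WordPoset → ℕ → Set
IndIs δ r P v = Σ[ c ∈ (Fin r → Fin (size P)) ]
  (IsChain δ r P c × v ≡ sum (map (λ i → countAbove P (c i)) (allFin r)))

InI : (r : ℕ) (P : WordPoset) → (Fin r → Fin (size P)) → Fin (size P) → Set
InI r P c k = Σ[ i ∈ Fin r ] (T (P ⊢ k <ᵖ c i) × label P k ≡ label P (c i))

ContrLabel : Dir → (r : ℕ) (P : WordPoset) → (Fin r → Fin (size P)) →
             Fin (size P) → ℕ → Set
ContrLabel 𝖣 r P c p m = (InI r P c p → m ≡ label P p) × (¬ InI r P c p → m ≡ label P p ∸ 1)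
ContrLabel 𝖠 r P c p m = (InI r P c p → m ≡ label P p ∸ 1) × (¬ InI r P c p → m ≡ label P p)

-- Q ∼ C_δ(P): ψ identifies Q with P ∖ δ(P) (induced order) and the
-- labels of Q are given by the contraction rule
IsContraction : Dir → (r : ℕ) → WordPoset → WordPoset → Set
IsContraction δ r P Q =
  Σ[ c ∈ (Fin r → Fin (size P)) ] (IsChain δ r P c ×
  Σ[ ψ ∈ (Fin (size Q) → Fin (size P)) ]
    ((∀ q q′ → ψ q ≡ ψ q′ → q ≡ q′) ×
     (∀ q (i : Fin r) → ψ q ≢ c i) ×
     (∀ p → (∀ (i : Fin r) → p ≢ c i) → Σ[ q ∈ Fin (size Q) ] ψ q ≡ p) ×
     (∀ q q′ → _≤ᵖ_ Q q q′ ≡ _≤ᵖ_ P (ψ q) (ψ q′)) ×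
     (∀ q → ContrLabel δ r P c (ψ q) (label Q q))))

-- ind_δ(P) = I for P of rank m+1 and δ = (δ₁,…,δ_m), I = (I₁,…,I_m):
-- I_m = ind_{δ_m}(P), and (I₁,…,I_{m-1}) = ind_{(δ₁,…,δ_{m-1})}(C_{δ_m}(P))
IndVecIs : (m : ℕ) → WordPoset → Vec Dir m → Vec ℕ m → Set
IndVecIs zero    P [] [] = Data.Unit.⊤
  where import Data.Unit
IndVecIs (suc m) P δ I =
  IndIs (last δ) (suc (suc m)) P (last I) ×
  Σ[ Q ∈ WordPoset ] (IsContraction (last δ) (suc (suc m)) P Q ×
                      IndVecIs m Q (init δ) (init I))

GCType : ℕ → WordPoset → Set
GCType zero    P = Data.Unit.⊤
  where import Data.Unit
GCType (suc m) P = Σ[ δ ∈ Vec Dir m ] IndVecIs m P δ (replicate m 0)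

GCWord : ℕ → Set
GCWord n = Σ[ i ∈ List ℕ ] (IsReducedW₀ n i × GCType n P[ i ])

_≈W_ : ∀ {n} → GCWord n → GCWord n → Set
x ≈W y = proj₁ x ∼comm proj₁ y

GCPoset : ℕ → Set
GCPoset n = Σ[ P ∈ WordPoset ] (InP-w₀ n P × GCType n P)

_≈P_ : ∀ {n} → GCPoset n → GCPoset n → Set
x ≈P y = proj₁ x ≅ proj₁ y

toPoset : ∀ n → GCWord n → GCPoset n
toPoset n (i , red , gc) = P[ i ] , (i , red , ≅-refl) , gc

-- P_𝐢 is the heap of the word 𝐢: commutation moves permute positions while
-- preserving labels and covering relations, so [𝐢] ↦ [P_𝐢] is well defined.
-- In a reduced word any two occurrences of a letter are comparable in P_𝐢:
-- otherwise, by induction on their distance, two occurrences are separated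
-- only by letters commuting with them, and cancelling them shortens the word. For
-- such words an isomorphism P_𝐢 ≅ P_𝐣 sends some minimal position of 𝐢 to the
-- first position of 𝐣; that letter commutes with everything before it, so it
-- can be moved to the front of 𝐢 and induction on the length applies.
-- Surjectivity holds because being of Gelfand–Cetlin type is a property of
-- the isomorphism class of a word poset.
module Submission where

open import Defs
open import Data.Nat using (ℕ; NonZero)
open import Function.Structures using (IsBijection)

open import Data.Nat using (zero; suc; _+_; _∸_; _≤_; _<_; _≡ᵇ_; ∣_-_∣; z≤n; s≤s; z<s; s<s)
open import Data.Nat.Properties
  using (≤-refl; ≤-reflexive; ≤-trans; <⇒≤; <⇒≱; ≰⇒>; <-cmp; <-irrefl; m≤n+m; m≤m+n;
         +-suc; +-monoʳ-≤; +-monoˡ-≤;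
         +-identityʳ; ≤-pred; <ᵇ⇒<; <⇒<ᵇ; ≡⇒≡ᵇ; ∣-∣-comm; ∣m-n∣≡0⇒m≡n; _<?_; _≤?_;
         +-0-commutativeMonoid)
open import Data.Bool using (true; false; _∧_; not; T; if_then_else_)
open import Data.Bool.Properties using (T-∧; T-∨)
open import Data.Fin using (Fin; toℕ) renaming (zero to 0F; suc to fs)
import Data.Fin as Fin
open import Data.Fin.Properties using (toℕ-injective; toℕ<n; any?)
open import Data.Fin.Permutation using (lift₀; remove; lift₀-remove; transpose)
open import Data.List using (List; []; _∷_; _++_; length; lookup; allFin; map; removeAt; tabulate)
open import Data.List.Properties using (map-tabulate; map-cong)
open import Data.List.Membership.Propositional using (lose)
open import Data.List.Membership.Propositional.Properties using (∈-allFin)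
open import Data.List.Relation.Unary.Any using (satisfied)
open import Data.List.Relation.Unary.Any.Properties using (any⁺; any⁻)
open import Data.List.Relation.Binary.Sublist.Propositional using (_⊆_; _∷_; _∷ʳ_; ⊆-refl)
open import Data.List.Relation.Binary.Sublist.Propositional.Properties using (All-resp-⊆)
open import Data.List.Relation.Binary.Sublist.Heterogeneous.Properties using (length-mono-≤)
open import Data.Nat.ListAction using (sum)
import Algebra.Properties.CommutativeMonoid.Sum as MonoidSum
open import Data.Vec using (last)
import Data.Vec as Vec
open import Data.Product using (Σ-syntax; ∃-syntax; _×_; _,_; proj₁; proj₂)
open import Data.Sum using (_⊎_; inj₁; inj₂)
import Data.Sum as Sum
open import Data.Empty using (⊥-elim)
open import Data.Unit using (tt)
open import Function using (_∘_; _⇔_)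
open import Function.Bundles using (_↔_; Inverse; Injection; Equivalence)
open import Function.Properties.Inverse using (↔⇒↣)
open import Function.Construct.Symmetry using (↔-sym)
open import Function.Construct.Composition using (_↔-∘_)
open import Relation.Nullary using (¬_; yes; no; _×-dec_)
open import Relation.Nullary.Decidable using (⌊_⌋; toWitness; fromWitness)
open import Relation.Binary using (tri<; tri≈; tri>)
open import Relation.Binary.Structures using (IsEquivalence)
open import Relation.Binary.PropositionalEquality
  using (_≡_; _≢_; refl; sym; trans; cong; cong₂; subst; subst₂; module ≡-Reasoning)
open import Relation.Binary.Construct.Closure.ReflexiveTransitive using (Star; ε; _◅_; _◅◅_; gmap)
open import Relation.Binary.Construct.Closure.Symmetric using (fwd)
import Relation.Binary.Construct.Closure.Equivalence as EqClosure
import Relation.Binary.Construct.On as On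

open Inverse using (to; from; strictlyInverseˡ; strictlyInverseʳ)

swapAt-involutive : ∀ a w → swapAt a (swapAt a w) ≡ w
swapAt-involutive zero          w           = refl
swapAt-involutive (suc zero)    []          = refl
swapAt-involutive (suc zero)    (x ∷ [])    = refl
swapAt-involutive (suc zero)    (x ∷ y ∷ w) = refl
swapAt-involutive (suc (suc a)) []          = refl
swapAt-involutive (suc (suc a)) (x ∷ w)     = cong (x ∷_) (swapAt-involutive (suc a) w)

swapAt-commute : ∀ a b w → 1 < ∣ a - b ∣ → swapAt a (swapAt b w) ≡ swapAt b (swapAt a w)
swapAt-commute zero                b                   w           _ = refl
swapAt-commute (suc a)             zero                w           _ = refl
swapAt-commute (suc zero)          (suc zero)          w           ()
swapAt-commute (suc zero)          (suc (suc zero))    w           (s≤s ())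
swapAt-commute (suc (suc zero))    (suc zero)          w           (s≤s ())
swapAt-commute (suc zero)          (suc (suc (suc b))) []          _ = refl
swapAt-commute (suc zero)          (suc (suc (suc b))) (x ∷ [])    _ = refl
swapAt-commute (suc zero)          (suc (suc (suc b))) (x ∷ y ∷ w) _ = refl
swapAt-commute (suc (suc (suc a))) (suc zero)          []          _ = refl
swapAt-commute (suc (suc (suc a))) (suc zero)          (x ∷ [])    _ = refl
swapAt-commute (suc (suc (suc a))) (suc zero)          (x ∷ y ∷ w) _ = refl
swapAt-commute (suc (suc a))       (suc (suc b))       []          _ = refl
swapAt-commute (suc (suc a))       (suc (suc b))       (x ∷ w)     h =
  cong (x ∷_) (swapAt-commute (suc a) (suc b) w h)

prodFrom-cancel : ∀ a (l : List ℕ) (r : Fin (length l)) → lookup l r ≡ a →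
  (∀ s → toℕ s < toℕ r → 1 < ∣ lookup l s - a ∣) →
  ∀ w → prodFrom (swapAt a w) l ≡ prodFrom w (removeAt l r)
prodFrom-cancel a (x ∷ l) 0F     refl _ w = cong (λ v → prodFrom v l) (swapAt-involutive x w)
prodFrom-cancel a (x ∷ l) (fs r) lr≡a h w = begin
  prodFrom (swapAt x (swapAt a w)) l ≡⟨ cong (λ v → prodFrom v l) (swapAt-commute x a w (h 0F z<s)) ⟩
  prodFrom (swapAt a (swapAt x w)) l
    ≡⟨ prodFrom-cancel a l r lr≡a (λ s s<r → h (fs s) (s<s s<r)) (swapAt x w) ⟩
  prodFrom (swapAt x w) (removeAt l r) ∎
  where open ≡-Reasoning

removeAt-⊆ : (l : List ℕ) (r : Fin (length l)) → removeAt l r ⊆ l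
removeAt-⊆ (x ∷ l) 0F     = x ∷ʳ ⊆-refl
removeAt-⊆ (x ∷ l) (fs r) = refl ∷ removeAt-⊆ l r

record CancellingPair (i : List ℕ) (q r : Fin (length i)) : Set where
  field
    ordered  : toℕ q < toℕ r
    same     : lookup i q ≡ lookup i r
    commutes : ∀ s → toℕ q < toℕ s → toℕ s < toℕ r → 1 < ∣ lookup i s - lookup i q ∣

removeCancellingPair : ∀ i {q r} → CancellingPair i q r →
  Σ[ j ∈ List ℕ ] (j ⊆ i × length j < length i × (∀ w → prodFrom w j ≡ prodFrom w i))
removeCancellingPair (a ∷ i) {0F} {fs r} c =
  removeAt i r , a ∷ʳ removeAt-⊆ i r , s≤s (length-mono-≤ (removeAt-⊆ i r)) ,
  λ w → sym (prodFrom-cancel a i r (sym same) (λ s s<r → commutes (fs s) z<s (s<s s<r)) w)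
  where open CancellingPair c
removeCancellingPair (x ∷ i) {fs q} {fs r} c
  with removeCancellingPair i {q} {r} record
    { ordered  = ≤-pred ordered
    ; same     = same
    ; commutes = λ s q<s s<r → commutes (fs s) (s<s q<s) (s<s s<r) }
  where open CancellingPair c
... | j , j⊆i , shorter , sameProd = x ∷ j , refl ∷ j⊆i , s<s shorter , λ w → sameProd (swapAt x w)

reduced⇒noCancellingPair : ∀ {n i} → IsReducedW₀ n i → ∀ q r → ¬ CancellingPair i q r
reduced⇒noCancellingPair {n} {i} (valid , i≡w₀ , minimal) q r c
  with removeCancellingPair i c
... | j , j⊆i , shorter , sameProd =
  <⇒≱ shorter (minimal j (All-resp-⊆ j⊆i valid) (trans (sameProd (idPerm n)) i≡w₀))

-- The order of P_𝐢 as reachability along covering relations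

Cover : (i : List ℕ) → Fin (length i) → Fin (length i) → Set
Cover i x y = T (genRel i x y)

Below : (i : List ℕ) → Fin (length i) → Fin (length i) → Set
Below i = Star (Cover i)

module _ {i : List ℕ} where

  cover⇒< : ∀ {x y} → Cover i x y → toℕ x < toℕ y
  cover⇒< c = <ᵇ⇒< _ _ (proj₁ (Equivalence.to T-∧ c))

  cover-intro : ∀ {x y} → toℕ x < toℕ y → ∣ lookup i x - lookup i y ∣ ≡ 1 → Cover i x y
  cover-intro x<y d≡1 = Equivalence.from T-∧ (<⇒<ᵇ x<y , ≡⇒≡ᵇ _ _ d≡1)

  below⇒≤ : ∀ {x y} → Below i x y → toℕ x ≤ toℕ y
  below⇒≤ ε       = ≤-refl
  below⇒≤ (c ◅ p) = ≤-trans (<⇒≤ (cover⇒< c)) (below⇒≤ p)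

  reach⇒below : ∀ fuel x y → T (reach fuel (genRel i) x y) → Below i x y
  reach⇒below zero x y t with toWitness {a? = x Fin.≟ y} t
  ... | refl = ε
  reach⇒below (suc fuel) x y t with Equivalence.to T-∨ t
  ... | inj₁ x≡y with toWitness {a? = x Fin.≟ y} x≡y
  ... | refl = ε
  reach⇒below (suc fuel) x y t | inj₂ viaSome with satisfied (any⁻ _ (allFin _) viaSome)
  ... | z , t′ = proj₁ (Equivalence.to T-∧ t′) ◅ reach⇒below fuel z y (proj₂ (Equivalence.to T-∧ t′))

  -- Enough fuel: every cover increases the position, which is below length i.
  below⇒reach : ∀ {x y} → Below i x y → ∀ fuel → length i ≤ fuel + toℕ x → T (reach fuel (genRel i) x y)
  below⇒reach {x} ε zero _ = fromWitness {a? = x Fin.≟ x} refl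
  below⇒reach {x} ε (suc fuel) _ = Equivalence.from T-∨ (inj₁ (fromWitness {a? = x Fin.≟ x} refl))
  below⇒reach {x} (c ◅ p) zero bound = ⊥-elim (<⇒≱ (toℕ<n x) bound)
  below⇒reach {x} (_◅_ {j = z} c p) (suc fuel) bound =
    Equivalence.from T-∨ (inj₂ (any⁺ _ (lose (∈-allFin z)
      (Equivalence.from T-∧ (c , below⇒reach p fuel bound′)))))
    where
    bound′ : length i ≤ fuel + toℕ z
    bound′ = ≤-trans bound (≤-trans (≤-reflexive (sym (+-suc fuel (toℕ x)))) (+-monoʳ-≤ fuel (cover⇒< c)))

  ≤ᵖ⇒below : ∀ {x y} → T (_≤ᵖ_ P[ i ] x y) → Below i x y
  ≤ᵖ⇒below = reach⇒below (length i) _ _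

  below⇒≤ᵖ : ∀ {x y} → Below i x y → T (_≤ᵖ_ P[ i ] x y)
  below⇒≤ᵖ p = below⇒reach p (length i) (m≤m+n _ _)

T-ext : ∀ {a b} → (T a → T b) → (T b → T a) → a ≡ b
T-ext {true}  {true}  _ _ = refl
T-ext {true}  {false} f _ = ⊥-elim (f tt)
T-ext {false} {true}  _ g = ⊥-elim (g tt)
T-ext {false} {false} _ _ = refl

≤ᵖ-≡ : ∀ {i j x y x′ y′} → (Below i x y → Below j x′ y′) → (Below j x′ y′ → Below i x y) →
       _≤ᵖ_ P[ i ] x y ≡ _≤ᵖ_ P[ j ] x′ y′
≤ᵖ-≡ {i} {j} f g = T-ext (below⇒≤ᵖ {j} ∘ f ∘ ≤ᵖ⇒below {i}) (below⇒≤ᵖ {i} ∘ g ∘ ≤ᵖ⇒below {j})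

-- Equal letters of a reduced word are comparable

EqualLettersComparable : List ℕ → Set
EqualLettersComparable i = ∀ q r → lookup i q ≡ lookup i r → Below i q r ⊎ Below i r q

module _ {i : List ℕ} (noPair : ∀ q r → ¬ CancellingPair i q r) where

  neighbourBetween : ∀ {q r} → toℕ q < toℕ r → lookup i q ≡ lookup i r →
    ∃[ s ] ((toℕ q < toℕ s × toℕ s < toℕ r) × ∣ lookup i s - lookup i q ∣ ≤ 1)
  neighbourBetween {q} {r} q<r same
    with any? (λ s → ((toℕ q <? toℕ s) ×-dec (toℕ s <? toℕ r)) ×-dec (∣ lookup i s - lookup i q ∣ ≤? 1))
  ... | yes found = found
  ... | no none = ⊥-elim (noPair q r record
    { ordered = q<r ; same = same
    ; commutes = λ s q<s s<r → ≰⇒> (λ near → none (s , (q<s , s<r) , near)) })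

  -- Split at an occurrence of the same letter, or step through a neighbouring letter.
  sameLetter⇒below : ∀ fuel {q r} → toℕ q < toℕ r → toℕ r ≤ toℕ q + fuel →
                     lookup i q ≡ lookup i r → Below i q r
  sameLetter⇒below zero {q} q<r bound _ =
    ⊥-elim (<⇒≱ q<r (subst (_ ≤_) (+-identityʳ (toℕ q)) bound))
  sameLetter⇒below (suc fuel) {q} {r} q<r bound same
    with neighbourBetween q<r same
  ... | s , (q<s , s<r) , near with ∣ lookup i s - lookup i q ∣ in d
  ... | zero =
    sameLetter⇒below fuel q<s s≤q+fuel (sym s≡q) ◅◅ sameLetter⇒below fuel s<r r≤s+fuel (trans s≡q same)
    where
    s≡q = ∣m-n∣≡0⇒m≡n d
    s≤q+fuel : toℕ s ≤ toℕ q + fuel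
    s≤q+fuel = ≤-pred (≤-trans s<r (subst (toℕ r ≤_) (+-suc (toℕ q) fuel) bound))
    r≤s+fuel : toℕ r ≤ toℕ s + fuel
    r≤s+fuel = ≤-trans bound (subst (_≤ toℕ s + fuel) (sym (+-suc (toℕ q) fuel)) (+-monoˡ-≤ fuel q<s))
  ... | suc zero =
    cover-intro {i} q<s (trans (∣-∣-comm (lookup i q) (lookup i s)) d) ◅
    cover-intro {i} s<r (trans (cong (λ a → ∣ lookup i s - a ∣) (sym same)) d) ◅ ε
  ... | suc (suc _) with near
  ... | s≤s ()

  noCancellingPair⇒comparable : EqualLettersComparable i
  noCancellingPair⇒comparable q r same with <-cmp (toℕ q) (toℕ r)
  ... | tri< q<r _ _ = inj₁ (sameLetter⇒below (toℕ r) q<r (m≤n+m _ _) same)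
  ... | tri≈ _ q≡r _ with toℕ-injective q≡r
  ... | refl = inj₁ ε
  noCancellingPair⇒comparable q r same | tri> _ _ r<q =
    inj₂ (sameLetter⇒below (toℕ q) r<q (m≤n+m _ _) (sym same))

reduced⇒comparable : ∀ {n i} → IsReducedW₀ n i → EqualLettersComparable i
reduced⇒comparable red = noCancellingPair⇒comparable (reduced⇒noCancellingPair red)

≅-sym : ∀ {P Q} → P ≅ Q → Q ≅ P
≅-sym {P} {Q} (φ , ord , lab) = ↔-sym φ , ord′ , lab′
  where
  ord′ : ∀ x y → _≤ᵖ_ Q x y ≡ _≤ᵖ_ P (from φ x) (from φ y)
  ord′ x y = sym (trans (ord (from φ x) (from φ y))
                        (cong₂ (_≤ᵖ_ Q) (strictlyInverseˡ φ x) (strictlyInverseˡ φ y)))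
  lab′ : ∀ x → label P (from φ x) ≡ label Q x
  lab′ x = trans (sym (lab (from φ x))) (cong (label Q) (strictlyInverseˡ φ x))

≅-trans : ∀ {P Q R} → P ≅ Q → Q ≅ R → P ≅ R
≅-trans (φ , ord₁ , lab₁) (ψ , ord₂ , lab₂) =
  ψ ↔-∘ φ , (λ x y → trans (ord₁ x y) (ord₂ (to φ x) (to φ y))) , (λ x → trans (lab₂ (to φ x)) (lab₁ x))

≅-isEquivalence : IsEquivalence _≅_
≅-isEquivalence = record
  { refl  = λ {P} → ≅-refl {P}
  ; sym   = λ {P} {Q} → ≅-sym {P} {Q}
  ; trans = λ {P} {Q} {R} → ≅-trans {P} {Q} {R}
  }

module _ {i j : List ℕ} (φ : P[ i ] ≅ P[ j ]) where

  private
    π = proj₁ φ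

  ≅⇒below : ∀ {x y} → Below i x y → Below j (to π x) (to π y)
  ≅⇒below {x} {y} p = ≤ᵖ⇒below {j} (subst T (proj₁ (proj₂ φ) x y) (below⇒≤ᵖ {i} p))

  ≅⇒below⁻¹ : ∀ {x y} → Below j (to π x) (to π y) → Below i x y
  ≅⇒below⁻¹ {x} {y} p = ≤ᵖ⇒below {i} (subst T (sym (proj₁ (proj₂ φ) x y)) (below⇒≤ᵖ {j} p))

  ≅-lookup : ∀ x → lookup j (to π x) ≡ lookup i x
  ≅-lookup = proj₂ (proj₂ φ)

≅-comparable : ∀ {i j} → P[ i ] ≅ P[ j ] → EqualLettersComparable i → EqualLettersComparable j
≅-comparable {i} {j} φ comparable q r same =
  Sum.map (transport q r) (transport r q) (comparable (from π q) (from π r) sameFrom)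
  where
  π = proj₁ φ
  φ⁻¹ = ≅-sym {P[ i ]} {P[ j ]} φ
  sameFrom : lookup i (from π q) ≡ lookup i (from π r)
  sameFrom = trans (≅-lookup {j} {i} φ⁻¹ q) (trans same (sym (≅-lookup {j} {i} φ⁻¹ r)))
  transport : ∀ q r → Below i (from π q) (from π r) → Below j q r
  transport q r p = subst₂ (Below j) (strictlyInverseˡ π q) (strictlyInverseˡ π r) (≅⇒below {i} {j} φ p)

-- Commutation moves give isomorphic heaps

record CoverIso (i j : List ℕ) (σ : Fin (length i) ↔ Fin (length j)) : Set where
  field
    genRel-≡ : ∀ u v → genRel j (to σ u) (to σ v) ≡ genRel i u v
    lookup-≡ : ∀ u → lookup j (to σ u) ≡ lookup i u

coverIso⇒≅ : ∀ {i j σ} → CoverIso i j σ → P[ i ] ≅ P[ j ]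
coverIso⇒≅ {i} {j} {σ} iso = σ , (λ x y → ≤ᵖ-≡ {i} {j} (forward x y) (backward x y)) , lookup-≡
  where
  open CoverIso iso
  forward : ∀ x y → Below i x y → Below j (to σ x) (to σ y)
  forward x y = gmap (to σ) (λ {u} {v} c → subst T (sym (genRel-≡ u v)) c)
  coverFrom : ∀ {u v} → Cover j u v → Cover i (from σ u) (from σ v)
  coverFrom {u} {v} c = subst T (genRel-≡ (from σ u) (from σ v))
    (subst₂ (Cover j) (sym (strictlyInverseˡ σ u)) (sym (strictlyInverseˡ σ v)) c)
  backward : ∀ x y → Below j (to σ x) (to σ y) → Below i x y
  backward x y p = subst₂ (Below i) (strictlyInverseʳ σ x) (strictlyInverseʳ σ y) (gmap (from σ) coverFrom p)

≡ᵇ1-false : ∀ {d} → 1 < d → (d ≡ᵇ 1) ≡ false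
≡ᵇ1-false (s≤s (s≤s _)) = refl

coverIso-swap : ∀ a b l → 1 < ∣ a - b ∣ → CoverIso (a ∷ b ∷ l) (b ∷ a ∷ l) (transpose 0F (fs 0F))
coverIso-swap a b l far = record { genRel-≡ = covers ; lookup-≡ = letters }
  where
  covers : ∀ u v → _ ≡ _
  covers 0F          0F          = refl
  covers 0F          (fs 0F)     = sym (≡ᵇ1-false far)
  covers 0F          (fs (fs _)) = refl
  covers (fs 0F)     0F          = ≡ᵇ1-false (subst (1 <_) (∣-∣-comm a b) far)
  covers (fs 0F)     (fs 0F)     = refl
  covers (fs 0F)     (fs (fs _)) = refl
  covers (fs (fs _)) 0F          = refl
  covers (fs (fs _)) (fs 0F)     = refl
  covers (fs (fs _)) (fs (fs _)) = refl
  letters : ∀ u → _ ≡ _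
  letters 0F          = refl
  letters (fs 0F)     = refl
  letters (fs (fs _)) = refl

coverIso-cons : ∀ x {i j σ} → CoverIso i j σ → CoverIso (x ∷ i) (x ∷ j) (lift₀ σ)
coverIso-cons x iso = record { genRel-≡ = covers ; lookup-≡ = letters }
  where
  open CoverIso iso
  covers : ∀ u v → _ ≡ _
  covers 0F     0F     = refl
  covers 0F     (fs v) = cong (λ z → ∣ x - z ∣ ≡ᵇ 1) (lookup-≡ v)
  covers (fs u) 0F     = refl
  covers (fs u) (fs v) = genRel-≡ u v
  letters : ∀ u → _ ≡ _
  letters 0F     = refl
  letters (fs u) = lookup-≡ u

commStep-coverIso : ∀ pre a b post → 1 < ∣ a - b ∣ →
  Σ[ σ ∈ Fin (length (pre ++ a ∷ b ∷ post)) ↔ Fin (length (pre ++ b ∷ a ∷ post)) ]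
    CoverIso (pre ++ a ∷ b ∷ post) (pre ++ b ∷ a ∷ post) σ
commStep-coverIso []        a b post far = _ , coverIso-swap a b post far
commStep-coverIso (x ∷ pre) a b post far =
  _ , coverIso-cons x (proj₂ (commStep-coverIso pre a b post far))

commStep⇒≅ : ∀ {i j} → CommStep i j → P[ i ] ≅ P[ j ]
commStep⇒≅ (comm pre a b post far) = coverIso⇒≅ (proj₂ (commStep-coverIso pre a b post far))

∼comm⇒≅ : ∀ {i j} → i ∼comm j → P[ i ] ≅ P[ j ]
∼comm⇒≅ = EqClosure.gfold ≅-isEquivalence P[_] commStep⇒≅

-- Isomorphic heaps of reduced words are commutation equivalent

module _ {a : ℕ} {i : List ℕ} where

  below-0F : ∀ {x} → Below (a ∷ i) x 0F → x ≡ 0F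
  below-0F {0F}   _ = refl
  below-0F {fs x} p with below⇒≤ {a ∷ i} p
  ... | ()

  below-tail : ∀ {x y} → Below (a ∷ i) (fs x) (fs y) → Below i x y
  below-tail ε                = ε
  below-tail (_◅_ {j = 0F} () p)
  below-tail (_◅_ {j = fs z} c p) = c ◅ below-tail p

  below-cons : ∀ {x y} → Below i x y → Below (a ∷ i) (fs x) (fs y)
  below-cons = gmap fs (λ c → c)

  comparable-tail : EqualLettersComparable (a ∷ i) → EqualLettersComparable i
  comparable-tail comparable q r same = Sum.map below-tail below-tail (comparable (fs q) (fs r) same)

∼comm-cons : ∀ x {i j} → i ∼comm j → (x ∷ i) ∼comm (x ∷ j)
∼comm-cons x = EqClosure.gmap (x ∷_) (λ { (comm pre a b post far) → comm (x ∷ pre) a b post far })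

∼comm-toFront : ∀ (i : List ℕ) (p : Fin (length i)) →
  (∀ q → toℕ q < toℕ p → 1 < ∣ lookup i q - lookup i p ∣) →
  i ∼comm (lookup i p ∷ removeAt i p)
∼comm-toFront (a ∷ i) 0F     _   = ε
∼comm-toFront (x ∷ i) (fs p) far =
  ∼comm-cons x (∼comm-toFront i p (λ q q<p → far (fs q) (s<s q<p))) ◅◅
  (fwd (comm [] x (lookup i p) (removeAt i p) (far 0F z<s)) ◅ ε)

Minimal : (i : List ℕ) → Fin (length i) → Set
Minimal i x = ∀ q → Below i q x → q ≡ x

minimal⇒commutesWithEarlier : ∀ {i} → EqualLettersComparable i → ∀ {x} → Minimal i x →
  ∀ q → toℕ q < toℕ x → 1 < ∣ lookup i q - lookup i x ∣
minimal⇒commutesWithEarlier {i} comparable {x} minimal q q<x with ∣ lookup i q - lookup i x ∣ in d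
... | suc (suc _) = s≤s (s≤s z≤n)
... | suc zero    = ⊥-elim (<-irrefl (cong toℕ (minimal q (cover-intro {i} q<x d ◅ ε))) q<x)
... | zero with comparable q x (∣m-n∣≡0⇒m≡n d)
...   | inj₁ p = ⊥-elim (<-irrefl (cong toℕ (minimal q p)) q<x)
...   | inj₂ p = ⊥-elim (<⇒≱ q<x (below⇒≤ {i} p))

module _ {a b : ℕ} {i j : List ℕ} (φ : P[ a ∷ i ] ≅ P[ b ∷ j ]) where

  private
    π = proj₁ φ

  ≅-fixes-0F : a ≡ b → EqualLettersComparable (b ∷ j) → to π 0F ≡ 0F
  ≅-fixes-0F a≡b comparable with comparable 0F (to π 0F) (trans (sym a≡b) (sym (≅-lookup {a ∷ i} φ 0F)))
  ... | inj₂ p = below-0F {b} {j} p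
  ... | inj₁ p = begin
    to π 0F          ≡⟨ cong (to π) (sym from0≡0) ⟩
    to π (from π 0F) ≡⟨ strictlyInverseˡ π 0F ⟩
    0F               ∎
    where
    open ≡-Reasoning
    from0≡0 : from π 0F ≡ 0F
    from0≡0 = below-0F {a} {i} (≅⇒below⁻¹ {a ∷ i} φ
      (subst (λ z → Below (b ∷ j) z (to π 0F)) (sym (strictlyInverseˡ π 0F)) p))

  ≅-tail : to π 0F ≡ 0F → P[ i ] ≅ P[ j ]
  ≅-tail π0≡0 = ρ , (λ x y → ≤ᵖ-≡ {i} {j} (forward x y) (backward x y)) , letters
    where
    ρ = remove 0F π
    to-fs : ∀ x → to π (fs x) ≡ fs (to ρ x)
    to-fs x = sym (lift₀-remove π π0≡0 (fs x))
    forward : ∀ x y → Below i x y → Below j (to ρ x) (to ρ y)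
    forward x y p = below-tail {b}
      (subst₂ (Below (b ∷ j)) (to-fs x) (to-fs y) (≅⇒below {a ∷ i} φ (below-cons {a} p)))
    backward : ∀ x y → Below j (to ρ x) (to ρ y) → Below i x y
    backward x y p = below-tail {a} (≅⇒below⁻¹ {a ∷ i} φ
      (subst₂ (Below (b ∷ j)) (sym (to-fs x)) (sym (to-fs y)) (below-cons {b} p)))
    letters : ∀ x → lookup j (to ρ x) ≡ lookup i x
    letters x = trans (cong (lookup (b ∷ j)) (sym (to-fs x))) (≅-lookup {a ∷ i} φ (fs x))

≅⇒∼comm : ∀ i j → EqualLettersComparable i → EqualLettersComparable j → P[ i ] ≅ P[ j ] → i ∼comm j
≅⇒∼comm []      []      _ _ _       = ε
≅⇒∼comm (_ ∷ _) []      _ _ (π , _) with to π 0F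
... | ()
≅⇒∼comm i (a ∷ j) comparableᵢ comparableⱼ φ =
  subst (λ c → i ∼comm (c ∷ j)) letter (toFront ◅◅ ∼comm-cons (lookup i x) rest)
  where
  π = proj₁ φ
  x = from π 0F
  x-minimal : Minimal i x
  x-minimal q p = begin
    q                ≡⟨ strictlyInverseʳ π q ⟨
    from π (to π q)  ≡⟨ cong (from π) (below-0F {a} {j} πq≤0) ⟩
    x                ∎
    where
    open ≡-Reasoning
    πq≤0 : Below (a ∷ j) (to π q) 0F
    πq≤0 = subst (Below (a ∷ j) (to π q)) (strictlyInverseˡ π 0F) (≅⇒below {i} φ p)
  letter : lookup i x ≡ a
  letter = trans (sym (≅-lookup {i} φ x)) (cong (lookup (a ∷ j)) (strictlyInverseˡ π 0F))
  i′ = removeAt i x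
  toFront : i ∼comm (lookup i x ∷ i′)
  toFront = ∼comm-toFront i x (minimal⇒commutesWithEarlier {i} comparableᵢ x-minimal)
  ψ : P[ lookup i x ∷ i′ ] ≅ P[ a ∷ j ]
  ψ = ≅-trans {P[ lookup i x ∷ i′ ]} {P[ i ]} {P[ a ∷ j ]}
        (≅-sym {P[ i ]} {P[ lookup i x ∷ i′ ]} (∼comm⇒≅ toFront)) φ
  comparable′ : EqualLettersComparable i′
  comparable′ = comparable-tail (≅-comparable {i} (∼comm⇒≅ toFront) comparableᵢ)
  rest : i′ ∼comm j
  rest = ≅⇒∼comm i′ j comparable′ (comparable-tail comparableⱼ) (≅-tail ψ (≅-fixes-0F ψ letter comparableⱼ))

-- Being of Gelfand–Cetlin type is invariant under isomorphism

module ℕSum = MonoidSum +-0-commutativeMonoid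

sum-tabulate : ∀ n (g : Fin n → ℕ) → sum (tabulate g) ≡ ℕSum.sum g
sum-tabulate zero    g = refl
sum-tabulate (suc n) g = cong (g 0F +_) (sum-tabulate n (g ∘ fs))

sum-allFin-↔ : ∀ {m n} (π : Fin m ↔ Fin n) (g : Fin n → ℕ) →
  sum (map g (allFin n)) ≡ sum (map (g ∘ to π) (allFin m))
sum-allFin-↔ {m} {n} π g = begin
  sum (map g (allFin n))          ≡⟨ cong sum (map-tabulate (λ k → k) g) ⟩
  sum (tabulate g)                ≡⟨ sum-tabulate n g ⟩
  ℕSum.sum g                      ≡⟨ ℕSum.sum-permute g π ⟩
  ℕSum.sum (g ∘ to π)             ≡⟨ sum-tabulate m (g ∘ to π) ⟨
  sum (tabulate (g ∘ to π))       ≡⟨ cong sum (map-tabulate (λ k → k) (g ∘ to π)) ⟨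
  sum (map (g ∘ to π) (allFin m)) ∎
  where open ≡-Reasoning

⌊≟⌋-↔ : ∀ {m n} (π : Fin m ↔ Fin n) x y → ⌊ x Fin.≟ y ⌋ ≡ ⌊ to π x Fin.≟ to π y ⌋
⌊≟⌋-↔ π x y with x Fin.≟ y | to π x Fin.≟ to π y
... | yes _   | yes _     = refl
... | no _    | no _      = refl
... | yes x≡y | no πx≢πy  = ⊥-elim (πx≢πy (cong (to π) x≡y))
... | no x≢y  | yes πx≡πy = ⊥-elim (x≢y (Injection.injective (↔⇒↣ π) πx≡πy))

module _ {P Q : WordPoset} (φ : P ≅ Q) where

  private
    π = proj₁ φ
    ord = proj₁ (proj₂ φ)
    lab = proj₂ (proj₂ φ)

  <ᵖ-≅ : ∀ x y → (P ⊢ x <ᵖ y) ≡ (Q ⊢ to π x <ᵖ to π y)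
  <ᵖ-≅ x y = cong₂ _∧_ (ord x y) (cong not (⌊≟⌋-↔ π x y))

  IsChain-≅ : ∀ δ r c → IsChain δ r P c → IsChain δ r Q (to π ∘ c)
  IsChain-≅ δ r c (increasing , labels) =
    (λ k l k<l → subst T (<ᵖ-≅ (c k) (c l)) (increasing k l k<l)) , (λ k → trans (lab (c k)) (labels k))

  countAbove-≅ : ∀ x → countAbove Q (to π x) ≡ countAbove P x
  countAbove-≅ x = trans (sum-allFin-↔ π _) (cong sum (map-cong indicator-≅ (allFin (size P))))
    where
    indicator-≅ : ∀ k → (if (Q ⊢ to π x <ᵖ to π k) ∧ (label Q (to π k) ≡ᵇ label Q (to π x)) then 1 else 0) ≡
                        (if (P ⊢ x <ᵖ k) ∧ (label P k ≡ᵇ label P x) then 1 else 0)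
    indicator-≅ k rewrite lab k | lab x | <ᵖ-≅ x k = refl

  IndIs-≅ : ∀ δ r v → IndIs δ r P v → IndIs δ r Q v
  IndIs-≅ δ r v (c , chain , v≡) =
    to π ∘ c , IsChain-≅ δ r c chain , trans v≡ (cong sum (map-cong (sym ∘ countAbove-≅ ∘ c) (allFin r)))

  InI-≅ : ∀ r c k → InI r P c k ⇔ InI r Q (to π ∘ c) (to π k)
  InI-≅ r c k = record
    { to        = λ (l , k<cl , same) →
        l , subst T (<ᵖ-≅ k (c l)) k<cl , trans (lab k) (trans same (sym (lab (c l))))
    ; from      = λ (l , k<cl , same) →
        l , subst T (sym (<ᵖ-≅ k (c l))) k<cl , trans (sym (lab k)) (trans same (lab (c l)))
    ; to-cong   = λ { refl → refl }
    ; from-cong = λ { refl → refl }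
    }

  ContrLabel-≅ : ∀ δ r c p m → ContrLabel δ r P c p m → ContrLabel δ r Q (to π ∘ c) (to π p) m
  ContrLabel-≅ 𝖣 r c p m (inside , outside) =
    (λ h → trans (inside (Equivalence.from (InI-≅ r c p) h)) (sym (lab p))) ,
    (λ h → trans (outside (h ∘ Equivalence.to (InI-≅ r c p))) (cong (_∸ 1) (sym (lab p))))
  ContrLabel-≅ 𝖠 r c p m (inside , outside) =
    (λ h → trans (inside (Equivalence.from (InI-≅ r c p) h)) (cong (_∸ 1) (sym (lab p)))) ,
    (λ h → trans (outside (h ∘ Equivalence.to (InI-≅ r c p))) (sym (lab p)))

  IsContraction-≅ : ∀ δ r C → IsContraction δ r P C → IsContraction δ r Q C
  IsContraction-≅ δ r C (c , chain , ψ , injective , avoids , covers , order , labels) =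
    to π ∘ c , IsChain-≅ δ r c chain , to π ∘ ψ ,
    (λ q q′ e → injective q q′ (πinjective e)) ,
    (λ q l e → avoids q l (πinjective e)) ,
    covers′ ,
    (λ q q′ → trans (order q q′) (ord (ψ q) (ψ q′))) ,
    (λ q → ContrLabel-≅ δ r c (ψ q) (label C q) (labels q))
    where
    πinjective = Injection.injective (↔⇒↣ π)
    covers′ : ∀ p → (∀ l → p ≢ to π (c l)) → Σ[ q ∈ Fin (size C) ] to π (ψ q) ≡ p
    covers′ p p∉c with covers (from π p) (λ l e → p∉c l (trans (sym (strictlyInverseˡ π p)) (cong (to π) e)))
    ... | q , ψq≡ = q , trans (cong (to π) ψq≡) (strictlyInverseˡ π p)

IndVecIs-≅ : ∀ m {P Q} → P ≅ Q → ∀ δ I → IndVecIs m P δ I → IndVecIs m Q δ I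
IndVecIs-≅ zero    _ Vec.[] Vec.[] t = t
IndVecIs-≅ (suc m) {P} {Q} φ δ I (ind , C , contraction , rest) =
  IndIs-≅ {P} {Q} φ (last δ) (suc (suc m)) (last I) ind , C ,
  IsContraction-≅ {P} {Q} φ (last δ) (suc (suc m)) C contraction , rest

GCType-≅ : ∀ n {P Q} → P ≅ Q → GCType n P → GCType n Q
GCType-≅ zero                _ gc        = gc
GCType-≅ (suc m) {P} {Q} φ (δ , ind) = δ , IndVecIs-≅ m {P} {Q} φ δ _ ind

proposition4p4 : (n : ℕ) → .{{_ : NonZero n}} →
    IsBijection (_≈W_ {n}) (_≈P_ {n}) (toPoset n)
proposition4p4 n = record
  { isInjection = record
    { isCongruent = record
      { cong           = ∼comm⇒≅
      ; isEquivalence₁ = On.isEquivalence proj₁ (EqClosure.isEquivalence CommStep)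
      ; isEquivalence₂ = On.isEquivalence proj₁ ≅-isEquivalence
      }
    ; injective = λ { {i , i-reduced , _} {j , j-reduced , _} →
        ≅⇒∼comm i j (reduced⇒comparable i-reduced) (reduced⇒comparable j-reduced) }
    }
  ; surjective = λ { (P , (i , i-reduced , P≅Pᵢ) , gc) →
      (i , i-reduced , GCType-≅ n P≅Pᵢ gc) ,
      λ {k} k∼i → ≅-trans {P[ proj₁ k ]} {P[ i ]} {P} (∼comm⇒≅ k∼i) (≅-sym {P} {P[ i ]} P≅Pᵢ) }
  }
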